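{- Let $U=(E,\mathcal{I})$ be a uniform matroid that is finitary. Then either $U$ is free, or there is $n\in\mathbb{N}$ such that $U=U_{E,n}$, i.e. $\mathcal{I}=\{F\subseteq E:|F|\le n\}$.
   Context: Matroids are possibly infinite (B-)matroids: a matroid on $E$ is a pair $(E,\mathcal{I})$ with $\mathcal{I}\subseteq\mathcal{P}(E)$ such that (i) $\varnothing\in\mathcal{I}$; (ii) $\mathcal{I}$ is closed under subsets; (iii) for all $I,J\in\mathcal{I}$ with $J$ $\subseteq$-maximal in $\mathcal{I}$ and $I$ not maximal, there is $e\in J\setminus I$ with $I\cup\{e\}\in\mathcal{I}$; (iv) for every $X\subseteq E$, every $I\in\mathcal{I}$ with $I\subseteq X$ extends to a $\subseteq$-maximal element of $\{J\in\mathcal{I}:J\subseteq X\}$. Circuits are minimal dependent sets. A matroid is finitary if all its circuits are finite, and free if $\mathcal{I}=\mathcal{P}(E)$. A matroid $(E,\mathcal{I})$ is uniform if for every $I\in\mathcal{I}$, $e\in I$ and $f\in E\setminus I$ we have $(I\setminus\{e\})\cup\{f\}\in\mathcal{I}$. -}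

module Defs where

open import Level using (0ℓ)
open import Data.Nat using (ℕ; _≤_)
open import Data.List using (List; length)
open import Data.List.Membership.Propositional using (_∈_)
open import Data.Product using (Σ; _×_; ∃; ∃-syntax)
open import Data.Sum using (_⊎_)
open import Data.Empty using (⊥)
open import Relation.Nullary using (¬_)
open import Relation.Binary.PropositionalEquality using (_≡_)

Subset : Set → Set₁
Subset E = E → Set

module _ {E : Set} where

  _⊆_ : Subset E → Subset E → Set
  A ⊆ B = ∀ x → A x → B x

  ∅ : Subset E
  ∅ _ = ⊥

  ｛_｝ : E → Subset E
  ｛ e ｝ x = x ≡ e

  _∪_ : Subset E → Subset E → Subset E
  (A ∪ B) x = A x ⊎ B x

  _∖_ : Subset E → Subset E → Subset E
  (A ∖ B) x = A x × ¬ B x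

  Finite : Subset E → Set
  Finite A = Σ (List E) λ xs → A ⊆ (λ x → x ∈ xs)

  CardLE : Subset E → ℕ → Set
  CardLE A n = Σ (List E) λ xs → (length xs ≤ n) × (A ⊆ (λ x → x ∈ xs))

MaximalIn : {E : Set} → (Subset E → Set) → Subset E → Subset E → Set₁
MaximalIn 𝓘 X M = 𝓘 M × (M ⊆ X) × (∀ K → 𝓘 K → K ⊆ X → M ⊆ K → K ⊆ M)

Maximal : {E : Set} → (Subset E → Set) → Subset E → Set₁
Maximal 𝓘 M = MaximalIn 𝓘 (λ _ → Data.Unit.⊤) M
  where import Data.Unit

record IsMatroid {E : Set} (𝓘 : Subset E → Set) : Set₁ where
  field
    I1 : 𝓘 ∅
    I2 : ∀ I J → J ⊆ I → 𝓘 I → 𝓘 J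
    I3 : ∀ I J → 𝓘 I → Maximal 𝓘 J → ¬ Maximal 𝓘 I →
           ∃[ e ] (J e × ¬ I e × 𝓘 (I ∪ ｛ e ｝))
    I4 : ∀ X I → 𝓘 I → I ⊆ X → ∃[ M ] (I ⊆ M × MaximalIn 𝓘 X M)

module _ {E : Set} (𝓘 : Subset E → Set) where

  Circuit : Subset E → Set₁
  Circuit C = ¬ 𝓘 C × (∀ D → D ⊆ C → ¬ (C ⊆ D) → 𝓘 D)

  Finitary : Set₁
  Finitary = ∀ C → Circuit C → Finite C

  Free : Set₁
  Free = ∀ X → 𝓘 X

  Uniform : Set₁
  Uniform = ∀ I e f → 𝓘 I → I e → ¬ I f → 𝓘 ((I ∖ ｛ e ｝) ∪ ｛ f ｝)

  IsUniformOfRank : ℕ → Set₁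
  IsUniformOfRank n = ∀ F → (𝓘 F → CardLE F n) × (CardLE F n → 𝓘 F)

-- In a uniform matroid independence of a finite set depends only on its size:
-- exchanging one element at a time turns an independent set into any other
-- set of at most the same size. A dependent set X contains a circuit, namely
-- M ∪ {e} for a maximal independent M ⊆ X and e ∈ X ∖ M; so if every finite
-- set is independent, finitarity leaves no circuit and the matroid is free.
-- Otherwise, if n + 1 is the least size of a dependent finite set, the
-- independent sets are exactly those of size at most n.
module Submission where

open import Defs
open import Axiom.ExcludedMiddle using (ExcludedMiddle)
open import Axiom.DoubleNegationElimination using (em⇒dne)
open import Level using (0ℓ)
open import Data.Nat using (zero; suc; pred; _≤_; _<_; s≤s)
open import Data.Nat.Properties using (≤-refl; ≤-reflexive; ≤-trans; ≤-pred; n≤1+n; suc-injective)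
open import Data.List using (List; []; _∷_; length)
open import Data.List.Membership.Propositional using (_∈_; _∉_)
open import Data.List.Relation.Unary.Any using (here; there)
open import Data.List.Relation.Unary.All using (lookup)
open import Data.List.Relation.Unary.All.Properties using (¬Any⇒All¬; All¬⇒¬Any; anti-mono)
open import Data.List.Relation.Unary.Unique.Propositional using (Unique; []; _∷_)
open import Data.List.Relation.Binary.Subset.Propositional using () renaming (_⊆_ to _⊆ₗ_)
open import Data.List.Relation.Binary.Subset.Propositional.Properties using (∷⁺ʳ)
open import Data.Product using (∃-syntax; _×_; _,_)
open import Data.Sum using (_⊎_; inj₁; inj₂)
open import Data.Empty using (⊥; ⊥-elim)
open import Relation.Nullary using (¬_; Dec; yes; no)
open import Relation.Binary.PropositionalEquality using (_≡_; refl; sym; subst; cong)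

⟦_⟧ : {E : Set} → List E → Subset E
⟦ xs ⟧ x = x ∈ xs

∪-｛｝-⊆ : {E : Set} {A X : Subset E} {e : E} → A ⊆ X → X e → (A ∪ ｛ e ｝) ⊆ X
∪-｛｝-⊆ A⊆X Xe x (inj₁ Ax) = A⊆X x Ax
∪-｛｝-⊆ A⊆X Xe x (inj₂ refl) = Xe

Disjoint : {E : Set} → Subset E → Subset E → Set
Disjoint A B = ∀ x → A x → B x → ⊥

remove-unique : ∀ {a} {A : Set a} {z : A} {ws : List A} → z ∈ ws → Unique ws →
  ∃[ ws′ ] (suc (length ws′) ≡ length ws × ws′ ⊆ₗ ws × z ∉ ws′ × Unique ws′)
remove-unique (here refl) (x≢ws ∷ ws!) = _ , refl , there , All¬⇒¬Any x≢ws , ws!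
remove-unique {z = z} {ws = x ∷ _} (there z∈ws) (x≢ws ∷ ws!)
  with remove-unique z∈ws ws!
... | ws′ , len , ws′⊆ws , z∉ws′ , ws′! =
  x ∷ ws′ , cong suc len , ∷⁺ʳ x ws′⊆ws , z∉x∷ws′ , anti-mono ws′⊆ws x≢ws ∷ ws′!
  where
  z∉x∷ws′ : z ∉ x ∷ ws′
  z∉x∷ws′ (here refl) = lookup x≢ws z∈ws refl
  z∉x∷ws′ (there z∈ws′) = z∉ws′ z∈ws′

module UniformMatroid (em : ExcludedMiddle 0ℓ) {E : Set} (𝓘 : Subset E → Set)
  (matroid : IsMatroid 𝓘) (uniform : Uniform 𝓘) where
  open IsMatroid matroid

  dne : {P : Set} → ¬ ¬ P → P
  dne = em⇒dne em

  ⊆-or-∃∖ : (A B : Subset E) → A ⊆ B ⊎ ∃[ x ] (A x × ¬ B x)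
  ⊆-or-∃∖ A B with em {∃[ x ] (A x × ¬ B x)}
  ... | yes witness = inj₂ witness
  ... | no none = inj₁ λ x Ax → dne λ ¬Bx → none (x , Ax , ¬Bx)

  ⟦[]⟧-independent : 𝓘 ⟦ [] ⟧
  ⟦[]⟧-independent = I2 ∅ ⟦ [] ⟧ (λ _ ()) I1

  maximal-insert-circuit : ∀ {X M e} → MaximalIn 𝓘 X M → X e → ¬ M e →
    Circuit 𝓘 (M ∪ ｛ e ｝)
  maximal-insert-circuit {X} {M} {e} (𝓘M , M⊆X , M-maximal) Xe e∉M =
    dependent , proper-independent
    where
    dependent : ¬ 𝓘 (M ∪ ｛ e ｝)
    dependent 𝓘C = e∉M (M-maximal _ 𝓘C (∪-｛｝-⊆ M⊆X Xe) (λ _ → inj₁) e (inj₂ refl))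

    proper-independent : ∀ D → D ⊆ (M ∪ ｛ e ｝) → ¬ ((M ∪ ｛ e ｝) ⊆ D) → 𝓘 D
    proper-independent D D⊆C C⊈D with ⊆-or-∃∖ (M ∪ ｛ e ｝) D
    ... | inj₁ C⊆D = ⊥-elim (C⊈D C⊆D)
    ... | inj₂ (x , inj₂ refl , e∉D) = I2 M D D⊆M 𝓘M
      where
      D⊆M : D ⊆ M
      D⊆M y Dy with D⊆C y Dy
      ... | inj₁ My = My
      ... | inj₂ refl = ⊥-elim (e∉D Dy)
    ... | inj₂ (x , inj₁ Mx , x∉D) = I2 _ D D⊆exchange (uniform M x e 𝓘M Mx e∉M)
      where
      D⊆exchange : D ⊆ ((M ∖ ｛ x ｝) ∪ ｛ e ｝)
      D⊆exchange y Dy with D⊆C y Dy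
      ... | inj₁ My = inj₁ (My , λ { refl → x∉D Dy })
      ... | inj₂ y≡e = inj₂ y≡e

  dependent-contains-circuit : ∀ X → ¬ 𝓘 X → ∃[ C ] (Circuit 𝓘 C × C ⊆ X)
  dependent-contains-circuit X ¬𝓘X with I4 X ∅ I1 (λ _ ())
  ... | M , _ , M-max@(𝓘M , M⊆X , _) with ⊆-or-∃∖ X M
  ...   | inj₁ X⊆M = ⊥-elim (¬𝓘X (I2 M X X⊆M 𝓘M))
  ...   | inj₂ (e , Xe , e∉M) =
    M ∪ ｛ e ｝ , maximal-insert-circuit M-max Xe e∉M , ∪-｛｝-⊆ M⊆X Xe

  finite-independent⇒free : Finitary 𝓘 → (∀ xs → 𝓘 ⟦ xs ⟧) → Free 𝓘
  finite-independent⇒free finitary all-independent X with em {𝓘 X}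
  ... | yes 𝓘X = 𝓘X
  ... | no ¬𝓘X with dependent-contains-circuit X ¬𝓘X
  ...   | C , circuit@(¬𝓘C , _) , _ with finitary C circuit
  ...     | xs , C⊆xs = ⊥-elim (¬𝓘C (I2 ⟦ xs ⟧ C C⊆xs (all-independent xs)))

  IndependentWith : Subset E → List E → Set
  IndependentWith J ws = Unique ws × Disjoint J ⟦ ws ⟧ × 𝓘 (J ∪ ⟦ ws ⟧)

  -- z joins J at the cost of one element of ws: z itself if z ∈ ws, any
  -- element if z ∈ J, and otherwise w, by the uniform exchange of w for z.
  absorb : ∀ z J w ws → IndependentWith J (w ∷ ws) →
    ∃[ ws′ ] (length ws′ ≡ length ws × IndependentWith (J ∪ ｛ z ｝) ws′)
  absorb z J w ws (ws! , J#ws , 𝓘Jws) with em {z ∈ w ∷ ws} | em {J z}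
  ... | yes z∈ws | _ with remove-unique z∈ws ws!
  ...   | ws′ , len , ws′⊆ws , z∉ws′ , ws′! =
    ws′ , suc-injective len , ws′! , Jz#ws′ , I2 _ _ ⊆Jws 𝓘Jws
    where
    Jz#ws′ : Disjoint (J ∪ ｛ z ｝) ⟦ ws′ ⟧
    Jz#ws′ y (inj₁ Jy) y∈ws′ = J#ws y Jy (ws′⊆ws y∈ws′)
    Jz#ws′ y (inj₂ refl) = z∉ws′
    ⊆Jws : ((J ∪ ｛ z ｝) ∪ ⟦ ws′ ⟧) ⊆ (J ∪ ⟦ w ∷ ws ⟧)
    ⊆Jws y (inj₁ (inj₁ Jy)) = inj₁ Jy
    ⊆Jws y (inj₁ (inj₂ refl)) = inj₂ z∈ws
    ⊆Jws y (inj₂ y∈ws′) = inj₂ (ws′⊆ws y∈ws′)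
  absorb z J w ws (_ ∷ ws! , J#ws , 𝓘Jws) | no _ | yes Jz =
    ws , refl , ws! , Jz#ws , I2 _ _ ⊆Jws 𝓘Jws
    where
    Jz#ws : Disjoint (J ∪ ｛ z ｝) ⟦ ws ⟧
    Jz#ws y (inj₁ Jy) y∈ws = J#ws y Jy (there y∈ws)
    Jz#ws y (inj₂ refl) y∈ws = J#ws y Jz (there y∈ws)
    ⊆Jws : ((J ∪ ｛ z ｝) ∪ ⟦ ws ⟧) ⊆ (J ∪ ⟦ w ∷ ws ⟧)
    ⊆Jws y (inj₁ (inj₁ Jy)) = inj₁ Jy
    ⊆Jws y (inj₁ (inj₂ refl)) = inj₁ Jz
    ⊆Jws y (inj₂ y∈ws) = inj₂ (there y∈ws)
  absorb z J w ws (w≢ws ∷ ws! , J#ws , 𝓘Jws) | no z∉ws | no ¬Jz =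
    ws , refl , ws! , Jz#ws , I2 _ _ ⊆exchange (uniform _ w z 𝓘Jws (inj₂ (here refl)) z∉Jws)
    where
    z∉Jws : ¬ (J ∪ ⟦ w ∷ ws ⟧) z
    z∉Jws (inj₁ Jz) = ¬Jz Jz
    z∉Jws (inj₂ z∈ws) = z∉ws z∈ws
    Jz#ws : Disjoint (J ∪ ｛ z ｝) ⟦ ws ⟧
    Jz#ws y (inj₁ Jy) y∈ws = J#ws y Jy (there y∈ws)
    Jz#ws y (inj₂ refl) y∈ws = z∉ws (there y∈ws)
    ⊆exchange : ((J ∪ ｛ z ｝) ∪ ⟦ ws ⟧) ⊆ (((J ∪ ⟦ w ∷ ws ⟧) ∖ ｛ w ｝) ∪ ｛ z ｝)
    ⊆exchange y (inj₁ (inj₁ Jy)) = inj₁ (inj₁ Jy , λ { refl → J#ws w Jy (here refl) })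
    ⊆exchange y (inj₁ (inj₂ y≡z)) = inj₂ y≡z
    ⊆exchange y (inj₂ y∈ws) = inj₁ (inj₂ (there y∈ws) , λ { refl → lookup w≢ws y∈ws refl })

  transfer-independence : ∀ zs ws J → length zs ≤ length ws →
    IndependentWith J ws → 𝓘 (J ∪ ⟦ zs ⟧)
  transfer-independence [] ws J _ (_ , _ , 𝓘Jws) = I2 _ _ J⊆Jws 𝓘Jws
    where
    J⊆Jws : (J ∪ ⟦ [] ⟧) ⊆ (J ∪ ⟦ ws ⟧)
    J⊆Jws x (inj₁ Jx) = inj₁ Jx
  transfer-independence (z ∷ zs) (w ∷ ws) J (s≤s zs≤ws) independent
    with absorb z J w ws independent
  ... | ws′ , len , independent′ =
    I2 _ _ reassociate
      (transfer-independence zs ws′ (J ∪ ｛ z ｝) (subst (length zs ≤_) (sym len) zs≤ws) independent′)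
    where
    reassociate : (J ∪ ⟦ z ∷ zs ⟧) ⊆ ((J ∪ ｛ z ｝) ∪ ⟦ zs ⟧)
    reassociate x (inj₁ Jx) = inj₁ (inj₁ Jx)
    reassociate x (inj₂ (here x≡z)) = inj₁ (inj₂ x≡z)
    reassociate x (inj₂ (there x∈zs)) = inj₂ x∈zs

  shorter-independent : ∀ zs ws → length zs ≤ length ws → Unique ws →
    𝓘 ⟦ ws ⟧ → 𝓘 ⟦ zs ⟧
  shorter-independent zs ws zs≤ws ws! 𝓘ws =
    I2 _ _ (λ _ → inj₂) (transfer-independence zs ws ∅ zs≤ws (ws! , (λ _ ()) , I2 _ _ ⊆ws 𝓘ws))
    where
    ⊆ws : (∅ ∪ ⟦ ws ⟧) ⊆ ⟦ ws ⟧
    ⊆ws x (inj₂ x∈ws) = x∈ws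

  unique-sublist-of-length : ∀ (F : Subset E) m →
    (∀ xs → length xs < m → ¬ (F ⊆ ⟦ xs ⟧)) →
    ∃[ ys ] (length ys ≡ m × Unique ys × ⟦ ys ⟧ ⊆ F)
  unique-sublist-of-length F zero _ = [] , refl , [] , λ _ ()
  unique-sublist-of-length F (suc m) uncovered
    with unique-sublist-of-length F m (λ xs lt → uncovered xs (≤-trans lt (n≤1+n m)))
  ... | ys , refl , ys! , ys⊆F with ⊆-or-∃∖ F ⟦ ys ⟧
  ...   | inj₁ F⊆ys = ⊥-elim (uncovered ys ≤-refl F⊆ys)
  ...   | inj₂ (x , Fx , x∉ys) = x ∷ ys , refl , ¬Any⇒All¬ ys x∉ys ∷ ys! , x∷ys⊆F
    where
    x∷ys⊆F : ⟦ x ∷ ys ⟧ ⊆ F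
    x∷ys⊆F y (here refl) = Fx
    x∷ys⊆F y (there y∈ys) = ys⊆F y y∈ys

  MinimalDependent : List E → Set
  MinimalDependent zs = ¬ 𝓘 ⟦ zs ⟧ × (∀ ys → length ys < length zs → 𝓘 ⟦ ys ⟧)

  minimal-dependent-exists : ∀ m xs → length xs ≤ m → ¬ 𝓘 ⟦ xs ⟧ →
    ∃[ zs ] MinimalDependent zs
  minimal-dependent-exists m xs xs≤m dep
    with em {∃[ ys ] (length ys < length xs × ¬ 𝓘 ⟦ ys ⟧)}
  ... | no none = xs , dep , λ ys lt → dne λ dep′ → none (ys , lt , dep′)
  minimal-dependent-exists (suc m) xs xs≤m dep | yes (ys , ys<xs , dep′) =
    minimal-dependent-exists m ys (≤-pred (≤-trans ys<xs xs≤m)) dep′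
  minimal-dependent-exists zero xs xs≤m dep | yes (ys , ys<xs , _)
    with ≤-trans ys<xs xs≤m
  ... | ()

  minimal-dependent⇒rank : ∀ zs → MinimalDependent zs →
    IsUniformOfRank 𝓘 (pred (length zs))
  minimal-dependent⇒rank [] (dep , _) = ⊥-elim (dep ⟦[]⟧-independent)
  minimal-dependent⇒rank (z ∷ zs) (dep , shorter) F = independent⇒small , small⇒independent
    where
    small⇒independent : CardLE F (length zs) → 𝓘 F
    small⇒independent (xs , xs≤zs , F⊆xs) = I2 _ F F⊆xs (shorter xs (s≤s xs≤zs))

    independent⇒small : 𝓘 F → CardLE F (length zs)
    independent⇒small 𝓘F with em {CardLE F (length zs)}
    ... | yes small = small
    ... | no large with unique-sublist-of-length F (length (z ∷ zs))
                          (λ xs lt F⊆xs → large (xs , ≤-pred lt , F⊆xs))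
    ...   | ys , len , ys! , ys⊆F =
      ⊥-elim (dep (shorter-independent (z ∷ zs) ys (≤-reflexive (sym len)) ys! (I2 F _ ys⊆F 𝓘F)))

proposition2p5 : ExcludedMiddle 0ℓ → ExcludedMiddle (Level.suc 0ℓ) →
    {E : Set} (𝓘 : Subset E → Set) → IsMatroid 𝓘 → Uniform 𝓘 → Finitary 𝓘 →
    Free 𝓘 ⊎ ∃[ n ] IsUniformOfRank 𝓘 n
proposition2p5 em _ 𝓘 matroid uniform finitary = by-cases (em {∃[ xs ] ¬ 𝓘 ⟦ xs ⟧})
  where
  open UniformMatroid em 𝓘 matroid uniform

  by-cases : Dec (∃[ xs ] ¬ 𝓘 ⟦ xs ⟧) → Free 𝓘 ⊎ ∃[ n ] IsUniformOfRank 𝓘 n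
  by-cases (no none) = inj₁ (finite-independent⇒free finitary λ xs → dne λ dep → none (xs , dep))
  by-cases (yes (xs , dep)) with minimal-dependent-exists (length xs) xs ≤-refl dep
  ... | zs , minimal = inj₂ (_ , minimal-dependent⇒rank zs minimal)
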